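{- Let $G$ be a proper interval graph with vertices $1,\dots,n$ in canonical ordering, let $C\ge1$, and let $k=\lfloor(\omega(G)-1)/C\rfloor$. If vertex $i$ is primarily forbidden, then in no $[k+1,C]$-block partition of $G$ is there a part whose rightmost vertex (in canonical ordering) is $i$.
   Context: A proper interval graph has an interval representation (intervals on the real line, none properly containing another, distinct vertices adjacent iff intervals intersect). The canonical ordering orders vertices by left endpoint, ties broken by right endpoint; vertices are identified with their positions $1,\dots,n$. For $a\le b$, the block $[a,b]$ is the set $\{a,a+1,\dots,b\}$. $\omega(G)$ is the maximum clique size. A vertex $i$ is primarily forbidden if $1\le i-kC$, $i+1\le n$ and the block $[i-kC,i+1]$ is a clique. A $[\lambda,C]$-block partition of $G$ is a partition of the vertex set into blocks $P_j$, each inducing a connected subgraph, each of size at most $C$, such that every clique of $G$ intersects at most $\lambda$ parts.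
   Formalization: The interval representation of G has rational endpoints instead of intervals on the real line. -}

module Defs where

open import Data.Nat as ℕ using (ℕ; zero; suc; _+_; _*_; _∸_; NonZero)
open import Data.Nat.DivMod using (_/_)
open import Data.Rational as ℚ using (ℚ)
open import Data.Product using (Σ; _×_; _,_; ∃)
open import Data.Sum using (_⊎_)
open import Data.List using (List; []; _∷_; length; map; filter; upTo; lookup)
open import Data.List.Membership.Propositional using (_∈_)
open import Data.List.Relation.Unary.Any using (any?)
open import Data.List.Relation.Unary.All using (All)
open import Data.List.Relation.Unary.Unique.Propositional using (Unique)
open import Data.Fin using (Fin)
open import Relation.Nullary using (¬_; Dec)
open import Relation.Nullary.Decidable using (_×-dec_)
open import Relation.Binary.PropositionalEquality using (_≡_; _≢_)

InRange : ℕ → ℕ → Set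
InRange n v = 1 ℕ.≤ v × v ℕ.≤ n

-- A proper interval graph on vertices 1..n, given by a proper interval
-- representation (closed intervals [L v, R v]) listed in canonical order.

record ProperIntervalGraph (n : ℕ) : Set where
  field
    L R        : ℕ → ℚ
    nonempty   : ∀ v → InRange n v → L v ℚ.≤ R v
    proper     : ∀ u v → InRange n u → InRange n v →
                 ¬ (L u ℚ.≤ L v × R v ℚ.≤ R u × (L u ≢ L v ⊎ R u ≢ R v))
    canonical  : ∀ u v → InRange n u → InRange n v → u ℕ.< v →
                 L u ℚ.< L v ⊎ (L u ≡ L v × R u ℚ.≤ R v)

module _ {n : ℕ} (G : ProperIntervalGraph n) where
  open ProperIntervalGraph G

  Adj : ℕ → ℕ → Set
  Adj u v = InRange n u × InRange n v × u ≢ v × L u ℚ.≤ R v × L v ℚ.≤ R u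

  IsClique : List ℕ → Set
  IsClique K = All (InRange n) K × (∀ u v → u ∈ K → v ∈ K → u ≢ v → Adj u v)

  IsCliqueNumber : ℕ → Set
  IsCliqueNumber w =
    (Σ (List ℕ) λ K → IsClique K × Unique K × length K ≡ w) ×
    (∀ K → IsClique K → Unique K → length K ℕ.≤ w)

  data WalkIn (S : ℕ → Set) : ℕ → ℕ → Set where
    here : ∀ {u} → S u → WalkIn S u u
    step : ∀ {u v w} → S u → Adj u v → WalkIn S v w → WalkIn S u w

  ConnectedIn : (ℕ → Set) → Set
  ConnectedIn S = ∀ u v → S u → S v → WalkIn S u v

-- Blocks [a,b] = {a, a+1, …, b}, represented by the pair (a , b), a ≤ b.

InBlock : ℕ × ℕ → ℕ → Set
InBlock (a , b) v = a ℕ.≤ v × v ℕ.≤ b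

blockList : ℕ → ℕ → List ℕ
blockList a b = map (a +_) (upTo (suc b ∸ a))

blockSize : ℕ × ℕ → ℕ
blockSize (a , b) = suc b ∸ a

meets : (P : ℕ × ℕ) → (K : List ℕ) → Dec _
meets (a , b) K = any? (λ v → (a ℕ.≤? v) ×-dec (v ℕ.≤? b)) K

partsMeeting : List (ℕ × ℕ) → List ℕ → ℕ
partsMeeting ps K = length (filter (λ P → meets P K) ps)

module _ {n : ℕ} (G : ProperIntervalGraph n) where

  record IsBlockPartition (lam C : ℕ) (ps : List (ℕ × ℕ)) : Set where
    field
      blocks     : ∀ a b → (a , b) ∈ ps → 1 ℕ.≤ a × a ℕ.≤ b × b ℕ.≤ n
      covers     : ∀ v → InRange n v → Σ (ℕ × ℕ) λ P → P ∈ ps × InBlock P v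
      disjoint   : ∀ (i j : Fin (length ps)) v →
                   InBlock (lookup ps i) v → InBlock (lookup ps j) v → i ≡ j
      connected  : ∀ P → P ∈ ps → ConnectedIn G (InBlock P)
      small      : ∀ P → P ∈ ps → blockSize P ℕ.≤ C
      fewParts   : ∀ K → IsClique G K → partsMeeting ps K ℕ.≤ lam

  PrimarilyForbidden : (k C i : ℕ) → Set
  PrimarilyForbidden k C i =
    1 ℕ.≤ i ∸ k * C × i + 1 ℕ.≤ n ×
    IsClique G (blockList (i ∸ k * C) (i + 1))

module Submission where

-- Write k = ⌊(ω − 1)/C⌋ and suppose the block [a,i] is a part of a
-- [k+1,C]-block partition while i is primarily forbidden, i.e.
-- K = [i − kC, i+1] is a clique.  The kC + 1 vertices of V = [i − kC, i]
-- are covered by parts, each of which holds at most C of them, so at least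
-- k + 1 parts meet V (pigeonhole).  All of them meet K, and so does the part
-- containing i + 1; that part cannot meet V, since a part containing both
-- i + 1 and a vertex ≤ i would contain i and hence coincide with [a,i].
-- Thus K meets at least k + 2 parts, contradicting the [k+1,C] condition.
-- The argument works for every k.

open import Defs
open import Data.Nat using (ℕ; suc; _+_; _*_; _∸_; _≤_; _<_; _≤?_; z≤n; s≤s; NonZero)
open import Data.Nat.Properties
open import Data.Nat.DivMod using (_/_)
open import Data.Product using (Σ; _×_; _,_; proj₁; proj₂)
open import Data.Empty using (⊥)
open import Data.List using (List; []; _∷_; length; filter; lookup; upTo)
open import Data.List.Properties using (length-map; length-upTo; filter-notAll)
open import Data.List.Relation.Unary.All using (All; []; _∷_)
import Data.List.Relation.Unary.All as All
open import Data.List.Relation.Unary.All.Properties using (all-filter)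
open import Data.List.Relation.Unary.Any using (Any; here; there; index)
open import Data.List.Relation.Unary.Any.Properties using (lookup-index)
open import Data.List.Relation.Unary.AllPairs using (AllPairs; []; _∷_)
import Data.List.Relation.Unary.AllPairs.Properties as AllPairs
open import Data.List.Membership.Propositional using (_∈_; lose; find)
open import Data.List.Membership.Propositional.Properties
  using (∈-map⁻; ∈-map⁺; ∈-upTo⁻; ∈-upTo⁺; ∈-filter⁺; ∈-filter⁻)
open import Data.List.Relation.Binary.Sublist.Propositional using (_⊆_)
import Data.List.Relation.Binary.Sublist.Propositional.Properties as Sublist
open import Relation.Nullary using (¬_; yes; no; contradiction)
open import Relation.Nullary.Decidable using (_×-dec_)
open import Relation.Unary using (Decidable)
open import Relation.Unary.Properties using (∁?)
open import Relation.Binary.PropositionalEquality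
  using (_≡_; refl; sym; trans; cong; subst)

inBlock? : (P : ℕ × ℕ) → Decidable (InBlock P)
inBlock? (a , b) v = (a ≤? v) ×-dec (v ≤? b)

count : ℕ × ℕ → List ℕ → ℕ
count P xs = length (filter (inBlock? P) xs)

length-blockList : ∀ lo hi → length (blockList lo hi) ≡ suc hi ∸ lo
length-blockList lo hi =
  trans (length-map (lo +_) (upTo (suc hi ∸ lo))) (length-upTo (suc hi ∸ lo))

∈-blockList⁻ : ∀ {lo hi v} → v ∈ blockList lo hi → InBlock (lo , hi) v
∈-blockList⁻ {lo} {hi} v∈ with j , j∈ , refl ← ∈-map⁻ (lo +_) v∈ =
  m≤m+n lo j , <⇒≤pred lo+j<1+hi
  where
  j<len : j < suc hi ∸ lo
  j<len = ∈-upTo⁻ j∈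
  lo≤1+hi : lo ≤ suc hi
  lo≤1+hi = <⇒≤ (m∸n≢0⇒n<m (m<n⇒n≢0 (≤-<-trans z≤n j<len)))
  lo+j<1+hi : lo + j < suc hi
  lo+j<1+hi = subst (lo + j <_) (m+[n∸m]≡n lo≤1+hi) (+-monoʳ-< lo j<len)

∈-blockList⁺ : ∀ {lo hi v} → InBlock (lo , hi) v → v ∈ blockList lo hi
∈-blockList⁺ {lo} {hi} (lo≤v , v≤hi) =
  subst (_∈ blockList lo hi) (m+[n∸m]≡n lo≤v)
    (∈-map⁺ (lo +_) (∈-upTo⁺ (∸-monoˡ-< (s≤s v≤hi) lo≤v)))

blockList-extend : ∀ {lo hi hi′ v} → hi ≤ hi′ →
                   v ∈ blockList lo hi → v ∈ blockList lo hi′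
blockList-extend hi≤hi′ v∈ with lo≤v , v≤hi ← ∈-blockList⁻ v∈ =
  ∈-blockList⁺ (lo≤v , ≤-trans v≤hi hi≤hi′)

blockList-increasing : ∀ lo hi → AllPairs _<_ (blockList lo hi)
blockList-increasing lo hi =
  AllPairs.map⁺ (AllPairs.applyUpTo⁺₁ (λ j → j) (suc hi ∸ lo)
                   (λ j<j′ _ → +-monoʳ-< lo j<j′))

-- Capacity of a block: a strictly increasing list inside the block P has at
-- most |P| entries (each entry pushes the lower end of the block up by one).
increasing-in-block : ∀ P xs → AllPairs _<_ xs → All (InBlock P) xs →
                      length xs ≤ blockSize P
increasing-in-block P [] [] [] = z≤n
increasing-in-block (c , d) (x ∷ xs) (x<xs ∷ inc) ((c≤x , x≤d) ∷ inBlk) =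
  begin
    suc (length xs)  ≤⟨ s≤s (increasing-in-block (suc x , d) xs inc inRest) ⟩
    suc (d ∸ x)      ≡⟨ sym (+-∸-assoc 1 x≤d) ⟩
    suc d ∸ x        ≤⟨ ∸-monoʳ-≤ (suc d) c≤x ⟩
    suc d ∸ c        ∎
  where
  open ≤-Reasoning
  inRest : All (InBlock (suc x , d)) xs
  inRest = All.zipWith (λ (x<y , (_ , y≤d)) → x<y , y≤d) (x<xs , inBlk)

count-increasing : ∀ P xs → AllPairs _<_ xs → count P xs ≤ blockSize P
count-increasing P xs inc =
  increasing-in-block P _ (AllPairs.filter⁺ (inBlock? P) inc)
                          (all-filter (inBlock? P) xs)

length-split : ∀ {A : Set} {Q : A → Set} (Q? : Decidable Q) xs →
               length xs ≡ length (filter Q? xs) + length (filter (∁? Q?) xs)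
length-split Q? [] = refl
length-split Q? (x ∷ xs) with Q? x
... | yes _ = cong suc (length-split Q? xs)
... | no  _ = trans (cong suc (length-split Q? xs))
                    (sym (+-suc (length (filter Q? xs)) _))

count-⊆ : ∀ P {xs ys} → xs ⊆ ys → count P xs ≤ count P ys
count-⊆ P xs⊆ys =
  Sublist.length-mono-≤ (Sublist.filter⁺ (inBlock? P) (inBlock? P)
                           (λ { refl p → p }) xs⊆ys)

Covers : List (ℕ × ℕ) → List ℕ → Set
Covers ps xs = ∀ x → x ∈ xs → Σ (ℕ × ℕ) λ P → P ∈ ps × InBlock P x

pigeonhole : ∀ C ps xs → Covers ps xs → (∀ P → P ∈ ps → count P xs ≤ C) →
             length xs ≤ C * length ps
pigeonhole C [] [] _ _ = z≤n
pigeonhole C [] (x ∷ xs) cover _ with () ← proj₁ (proj₂ (cover x (here refl)))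
pigeonhole C (P ∷ ps) xs cover cap = begin
  length xs                    ≡⟨ length-split (inBlock? P) xs ⟩
  count P xs + length rest     ≤⟨ +-mono-≤ (cap P (here refl)) restBound ⟩
  C + C * length ps            ≡⟨ sym (*-suc C (length ps)) ⟩
  C * length (P ∷ ps)          ∎
  where
  open ≤-Reasoning
  rest : List ℕ
  rest = filter (∁? (inBlock? P)) xs

  restCovered : Covers ps rest
  restCovered x x∈rest with ∈-filter⁻ (∁? (inBlock? P)) x∈rest
  ... | x∈xs , x∉P with cover x x∈xs
  ...   | Q , here refl , x∈Q = contradiction x∈Q x∉P
  ...   | Q , there Q∈ps , x∈Q = Q , Q∈ps , x∈Q

  restBound : length rest ≤ C * length ps
  restBound = pigeonhole C ps rest restCovered λ Q Q∈ps →
    ≤-trans (count-⊆ Q (Sublist.filter-⊆ (∁? (inBlock? P)) xs))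
            (cap Q (there Q∈ps))

module _ {n : ℕ} {G : ProperIntervalGraph n} {lam C : ℕ} {ps : List (ℕ × ℕ)}
         (partition : IsBlockPartition G lam C ps) where
  open IsBlockPartition partition

  same-part : ∀ {P Q v} → P ∈ ps → Q ∈ ps → InBlock P v → InBlock Q v → P ≡ Q
  same-part {P} {Q} {v} P∈ Q∈ v∈P v∈Q =
    trans (lookup-index P∈)
          (trans (cong (lookup ps) sameIndex) (sym (lookup-index Q∈)))
    where
    sameIndex : index P∈ ≡ index Q∈
    sameIndex = disjoint (index P∈) (index Q∈) v
                  (subst (λ R → InBlock R v) (lookup-index P∈) v∈P)
                  (subst (λ R → InBlock R v) (lookup-index Q∈) v∈Q)

  -- If i is the rightmost vertex of a part, the part containing i + 1
  -- contains no vertex v ≤ i: otherwise it would contain i as well.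
  successor-part-starts-after : ∀ {a i Q v} → (a , i) ∈ ps → Q ∈ ps →
    InBlock Q (suc i) → InBlock Q v → v ≤ i → ⊥
  successor-part-starts-after {a} {i} {c , d} {v} ai∈ Q∈ (_ , i<d) (c≤v , _) v≤i =
    n≮n d (subst (_< d) (cong proj₂ aiIsQ) i<d)
    where
    aiIsQ : (a , i) ≡ (c , d)
    aiIsQ = same-part ai∈ Q∈ (proj₁ (proj₂ (blocks a i ai∈)) , ≤-refl)
                              (≤-trans c≤v v≤i , <⇒≤ i<d)

  partsMeetingBoth : List ℕ → ℕ → ℕ → List (ℕ × ℕ)
  partsMeetingBoth K lo hi =
    filter (λ P → meets P (blockList lo hi)) (filter (λ P → meets P K) ps)

  block-needs-parts : ∀ K {lo hi} → 1 ≤ lo → hi ≤ n →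
    (∀ {v} → v ∈ blockList lo hi → v ∈ K) →
    suc hi ∸ lo ≤ C * length (partsMeetingBoth K lo hi)
  block-needs-parts K {lo} {hi} 1≤lo hi≤n V⊆K = begin
    suc hi ∸ lo       ≡⟨ sym (length-blockList lo hi) ⟩
    length V          ≤⟨ pigeonhole C (partsMeetingBoth K lo hi) V covered capacity ⟩
    C * length (partsMeetingBoth K lo hi) ∎
    where
    open ≤-Reasoning
    V : List ℕ
    V = blockList lo hi

    covered : Covers (partsMeetingBoth K lo hi) V
    covered v v∈V with lo≤v , v≤hi ← ∈-blockList⁻ v∈V
      with P , P∈ps , v∈P ← covers v (≤-trans 1≤lo lo≤v , ≤-trans v≤hi hi≤n) =
      P , ∈-filter⁺ (λ P → meets P V)
            (∈-filter⁺ (λ P → meets P K) P∈ps (lose (V⊆K v∈V) v∈P))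
            (lose v∈V v∈P)
        , v∈P

    capacity : ∀ P → P ∈ partsMeetingBoth K lo hi → count P V ≤ C
    capacity P P∈ =
      ≤-trans (count-increasing P V (blockList-increasing lo hi))
              (small P (proj₁ (∈-filter⁻ _ (proj₁ (∈-filter⁻ _ P∈)))))

  -- If hi is the rightmost vertex of a part and K contains hi + 1, then the
  -- part containing hi + 1 meets K but not [lo,hi]; so strictly more parts
  -- meet K than meet both K and [lo,hi].
  rightmost-adds-part : ∀ K {a lo hi} → (a , hi) ∈ ps → hi + 1 ≤ n →
    hi + 1 ∈ K → length (partsMeetingBoth K lo hi) < partsMeeting ps K
  rightmost-adds-part K {a} {lo} {hi} ahi∈ps hi+1≤n hi+1∈K
    with Q , Q∈ps , hi+1∈Q ← covers (hi + 1) (m≤n+m 1 hi , hi+1≤n) =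
    filter-notAll (λ P → meets P (blockList lo hi)) (filter (λ P → meets P K) ps)
      (lose (∈-filter⁺ (λ P → meets P K) Q∈ps (lose hi+1∈K hi+1∈Q)) QmissesV)
    where
    QmissesV : ¬ Any (InBlock Q) (blockList lo hi)
    QmissesV QmeetsV with v , v∈V , v∈Q ← find QmeetsV =
      successor-part-starts-after ahi∈ps Q∈ps
        (subst (InBlock Q) (+-comm hi 1) hi+1∈Q) v∈Q (proj₂ (∈-blockList⁻ v∈V))

lemma8 : (n : ℕ) (G : ProperIntervalGraph n) (C : ℕ) .{{_ : NonZero C}}
         (w : ℕ) → IsCliqueNumber G w →
         (i : ℕ) → PrimarilyForbidden G ((w ∸ 1) / C) C i →
         (ps : List (ℕ × ℕ)) → IsBlockPartition G ((w ∸ 1) / C + 1) C ps →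
         ∀ a → ¬ ((a , i) ∈ ps)
lemma8 n G C w _ i (1≤lo , i+1≤n , clique) ps partition a ai∈ps =
  n≮n (k * C) tooMany
  where
  open IsBlockPartition partition using (fewParts)
  k lo : ℕ
  k = (w ∸ 1) / C
  lo = i ∸ k * C
  K : List ℕ
  K = blockList lo (i + 1)

  -- V = [lo,i] has kC + 1 vertices because lo = i ∸ kC ≥ 1.
  kC≤i : k * C ≤ i
  kC≤i = <⇒≤ (m∸n≢0⇒n<m (m<n⇒n≢0 1≤lo))

  -- The clique K meets at most k + 1 parts, one of which misses V.
  fewerThanK+1 : length (partsMeetingBoth partition K lo i) ≤ k
  fewerThanK+1 = ≤-pred (subst (length (partsMeetingBoth partition K lo i) <_)
                               (+-comm k 1)
    (<-≤-trans (rightmost-adds-part partition K {lo = lo} ai∈ps i+1≤n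
                  (∈-blockList⁺ (≤-trans (m∸n≤m i (k * C)) (m≤m+n i 1) , ≤-refl)))
               (fewParts K clique)))

  -- ... whereas covering the kC + 1 vertices of V needs more than k parts.
  tooMany : suc (k * C) ≤ k * C
  tooMany = begin
    suc (k * C)        ≡⟨ cong suc (sym (m∸[m∸n]≡n kC≤i)) ⟩
    suc (i ∸ lo)       ≡⟨ +-∸-assoc 1 (m∸n≤m i (k * C)) ⟨
    suc i ∸ lo         ≤⟨ block-needs-parts partition K 1≤lo (≤-trans (m≤m+n i 1) i+1≤n)
                            (blockList-extend (m≤m+n i 1)) ⟩
    C * length (partsMeetingBoth partition K lo i) ≤⟨ *-monoʳ-≤ C fewerThanK+1 ⟩
    C * k              ≡⟨ *-comm C k ⟩
    k * C              ∎
    where open ≤-Reasoning
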